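{- Let $G$ be a thick spider with spider partition $(S,K,R)$ where $|S|=|K|\ge3$, and let $e$ be a non-edge of $G$ with both endpoints in $S$. Then the ($P_4$-sparse,$+1$)-MinEdgeAddition Problem for $G$ and $e$ admits an optimal solution with exactly $\lambda$ fill edges (including $e$), where $\lambda=2$ if $|K|+|R|=3$ and $\lambda=3$ if $|K|+|R|\ge4$.
   Context: All graphs are finite, simple, undirected. A graph is $P_4$-sparse if no five vertices induce more than one $P_4$. A thick spider is a graph whose vertex set has a partition $(S,K,R)$ with $S$ independent, $K$ a clique, $|S|=|K|$, every vertex of $R$ adjacent to all of $K$ and none of $S$, and a bijection $f:S\to K$ with $N(s)\cap K=K\setminus\{f(s)\}$ for every $s\in S$. ($P_4$-sparse,$+1$)-MinEdgeAddition Problem: for a $P_4$-sparse graph $G$ and a non-edge $e$, a solution is a $P_4$-sparse graph $H$ with $V(H)=V(G)$ and $E(G)\cup\{e\}\subseteq E(H)$; fill edges are the edges of $E(H)\setminus E(G)$ (including $e$); an optimal solution minimizes their number. -}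

module Defs where

open import Data.Nat using (ℕ; zero; suc; _≤_; _<ᵇ_)
open import Data.Fin using (Fin; toℕ)
open import Data.Bool using (Bool; true; false; _∧_; not; if_then_else_)
open import Data.List using (List; []; _∷_; allFin; concatMap; map)
open import Data.List.Membership.Propositional using (_∈_)
open import Data.Product using (Σ; _×_; _,_)
open import Relation.Nullary using (¬_)
open import Relation.Binary.PropositionalEquality using (_≡_; _≢_)
open import Function.Definitions using (Injective)

record Graph (n : ℕ) : Set where
  field
    adj    : Fin n → Fin n → Bool
    sym    : ∀ u v → adj u v ≡ adj v u
    irrefl : ∀ u → adj u u ≡ false
open Graph public

E : ∀ {n} → Graph n → Fin n → Fin n → Set
E G u v = adj G u v ≡ true

-- a - b - c - d is an induced P4 (distinctness follows from these conditions)
IsP4 : ∀ {n} → Graph n → Fin n → Fin n → Fin n → Fin n → Set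
IsP4 G a b c d =
  E G a b × E G b c × E G c d × ¬ E G a c × ¬ E G b d × ¬ E G a d

-- P4-sparse: no five vertices induce more than one P4, i.e. for any five
-- distinct vertices v 0 … v 4, any two induced P4s among them have the
-- same vertex set.
P4Sparse : ∀ {n} → Graph n → Set
P4Sparse {n} G =
  (v : Fin 5 → Fin n) → Injective _≡_ _≡_ v →
  (a b c d a' b' c' d' : Fin 5) →
  IsP4 G (v a) (v b) (v c) (v d) → IsP4 G (v a') (v b') (v c') (v d') →
  (∀ x → x ∈ (a ∷ b ∷ c ∷ d ∷ []) → x ∈ (a' ∷ b' ∷ c' ∷ d' ∷ [])) ×
  (∀ x → x ∈ (a' ∷ b' ∷ c' ∷ d' ∷ []) → x ∈ (a ∷ b ∷ c ∷ d ∷ []))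

-- Thick spider partition (S,K,R) with |S| = |K| = k:
-- S = image of s, K = image of c, with bijection f(s i) = c i,
-- R = all remaining vertices.
record ThickSpider {n : ℕ} (G : Graph n) (k : ℕ) : Set where
  field
    s c      : Fin k → Fin n
    s-inj    : Injective _≡_ _≡_ s
    c-inj    : Injective _≡_ _≡_ c
    disjoint : ∀ i j → s i ≢ c j
    S-indep  : ∀ i j → ¬ E G (s i) (s j)
    K-clique : ∀ i j → i ≢ j → E G (c i) (c j)
    S-K-adj  : ∀ i j → (E G (s i) (c j) → i ≢ j) × (i ≢ j → E G (s i) (c j))
    R-adj    : ∀ v → (∀ i → v ≢ s i) → (∀ i → v ≢ c i) →
               (∀ j → E G v (c j)) × (∀ i → ¬ E G v (s i))

count : {A : Set} → (A → Bool) → List A → ℕ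
count p [] = 0
count p (x ∷ xs) = if p x then suc (count p xs) else count p xs

pairs : (n : ℕ) → List (Fin n × Fin n)
pairs n = concatMap (λ u → map (λ v → (u , v)) (allFin n)) (allFin n)

fill : ∀ {n} → Graph n → Graph n → ℕ
fill G H = count (λ { (u , v) → (toℕ u <ᵇ toℕ v) ∧ adj H u v ∧ not (adj G u v) }) (pairs _)

Solution : ∀ {n} → Graph n → Fin n → Fin n → Graph n → Set
Solution G x y H = P4Sparse H × (∀ u v → E G u v → E H u v) × E H x y

HasOptimalWith : ∀ {n} → Graph n → Fin n → Fin n → ℕ → Set
HasOptimalWith {n} G x y λ' =
  Σ (Graph n) λ H → Solution G x y H × fill G H ≡ λ' ×
    (∀ H' → Solution G x y H' → λ' ≤ fill G H')

-- Adding s i s j to the thick spider creates, for every vertex w ∉ {s i, s j} of S ∪ R, the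
-- induced paths w – c i – s j – s i and w – c j – s i – s j. They share three vertices, so a
-- P4-sparse solution must destroy one of them with a further fill edge. Taking w = s m for a
-- third index m shows that two fill edges are needed; when n − k = |K| + |R| ≥ 4 there is a
-- second such w (a fourth vertex of S or a vertex of R), and a case analysis on the pairs
-- s i s m, s j s m and s l c l gives a third fill edge. Conversely, adding s i c i and s j c j
-- makes c i and c j universal and s i, s j twins, so no new P4 appears. When n − k = 3 the
-- graph consists of s i, s j, s m and K only, and adding s i s m instead turns s i and c i
-- into a dominating pair, which lies on no P4.
module Submission where

open import Defs hiding (sym)
open import Data.Nat using (ℕ; suc; _+_; _∸_; _≤_; _<_; _<ᵇ_; s≤s; _<?_)
open import Data.Nat.Properties
  using ( module ≤-Reasoning; <⇒≱; ≮⇒≥; <ᵇ⇒<; <⇒<ᵇ; <-cmp; <-asym; ≤-antisym; ≤-trans; m≤m+n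
        ; +-monoˡ-≤; m+n≤o⇒m≤o∸n; m≤o∸n⇒m+n≤o)
open import Data.Fin using (Fin; toℕ; zero; suc; #_)
open import Data.Fin.Properties using (_≟_; toℕ-injective; injective⇒≤; all?; any?; ¬∀⟶∃¬)
open import Data.Bool using (Bool; true; false; T; _∧_; not; if_then_else_)
import Data.Bool.Properties as Bool
open import Data.Bool.Properties using (T-∧; T-≡; T-not-≡; ¬-not)
open import Data.List
  using (List; []; _∷_; length; lookup; filter; map; allFin; tabulate; concatMap; cartesianProduct; _++_)
open import Data.List.Properties using (length-tabulate; length-map; length-++)
open import Data.List.Membership.Propositional using (_∈_; _∉_)
open import Data.List.Membership.Propositional.Properties
  using ( ∈-lookup; ∈-allFin; ∈-map⁺; ∈-map⁻; ∈-concat⁺′; ∈-filter⁺; ∈-filter⁻; ∈-tabulate⁺; ∈-tabulate⁻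
        ; ∈-++⁺ˡ; ∈-++⁺ʳ; ∈-++⁻)
import Data.List.Membership.DecPropositional as DecMembership
open import Data.List.Membership.Setoid.Properties using (index-injective; ∉⇒All[≉])
open import Data.List.Relation.Binary.Subset.Propositional using (_⊆_)
open import Data.List.Relation.Unary.Any using (Any; here; there; index)
import Data.List.Relation.Unary.Any as Any
import Data.List.Relation.Unary.Any.Properties as Any
open import Data.List.Relation.Unary.All using (All; []; _∷_)
import Data.List.Relation.Unary.All as All
open import Data.List.Relation.Unary.All.Properties using (All¬⇒¬Any)
open import Data.List.Relation.Unary.AllPairs using (AllPairs; []; _∷_)
import Data.List.Relation.Unary.AllPairs as AllPairs
import Data.List.Relation.Unary.AllPairs.Properties as AllPairs
open import Data.List.Relation.Unary.Unique.Propositional using (Unique)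
import Data.List.Relation.Unary.Unique.Propositional.Properties as Unique
open import Data.Vec using (Vec; []; _∷_)
import Data.Vec as Vec
import Data.Vec.Relation.Unary.Unique.Propositional as Vec
import Data.Vec.Relation.Unary.Unique.Propositional.Properties as Vec
open import Data.Vec.Relation.Unary.All using ([]; _∷_)
open import Data.Vec.Relation.Unary.AllPairs using ([]; _∷_)
open import Data.Product using (∃; _×_; _,_; proj₁; proj₂; swap)
open import Data.Product.Properties using (≡-dec)
open import Data.Sum using (_⊎_; inj₁; inj₂)
open import Data.Empty using (⊥; ⊥-elim)
open import Relation.Nullary using (¬_; Dec; yes; no; does; contradiction; _×-dec_; _⊎-dec_; ¬?)
open import Relation.Nullary.Decidable using (T?; does-⇔; dec-false)
open import Relation.Binary.PropositionalEquality using (_≡_; _≢_; refl; sym; trans; cong; cong₂; subst; setoid)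
open import Relation.Binary.Definitions using (tri<; tri≈; tri>)
open import Function using (_∘_; id)
open import Function.Bundles using (_⇔_; mk⇔; Equivalence)
open import Function.Definitions using (Injective)

private variable n : ℕ

lookup-injective : {A : Set} {xs : List A} → Unique xs → Injective _≡_ _≡_ (lookup xs)
lookup-injective (_ ∷ _) {zero} {zero} _ = refl
lookup-injective (x∉xs ∷ _) {zero} {suc j} eq = contradiction eq (All.lookup x∉xs (∈-lookup j))
lookup-injective (x∉xs ∷ _) {suc i} {zero} eq = contradiction (sym eq) (All.lookup x∉xs (∈-lookup i))
lookup-injective (_ ∷ u) {suc i} {suc j} eq = cong suc (lookup-injective u eq)

unique⊆⇒length≤ : {A : Set} {xs ys : List A} → Unique xs → xs ⊆ ys → length xs ≤ length ys
unique⊆⇒length≤ {A} {xs} {ys} u xs⊆ys = injective⇒≤ {f = position} position-injective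
  where
  position : Fin (length xs) → Fin (length ys)
  position i = index (xs⊆ys (∈-lookup i))
  position-injective : Injective _≡_ _≡_ position
  position-injective {i} {j} eq =
    lookup-injective u (index-injective (setoid A) (xs⊆ys (∈-lookup i)) (xs⊆ys (∈-lookup j)) eq)

unique⇒length≤ : {xs : List (Fin n)} → Unique xs → length xs ≤ n
unique⇒length≤ {n} {xs} u = subst (length xs ≤_) (length-tabulate id) (unique⊆⇒length≤ u (λ _ → ∈-allFin _))

∉⇒length< : {xs : List (Fin n)} {z : Fin n} → Unique xs → z ∉ xs → length xs < n
∉⇒length< u z∉xs = unique⇒length≤ (∉⇒All[≉] (setoid _) z∉xs ∷ u)

unique∧n≤length⇒∈ : {xs : List (Fin n)} → Unique xs → n ≤ length xs → (z : Fin n) → z ∈ xs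
unique∧n≤length⇒∈ {xs = xs} u n≤|xs| z with DecMembership._∈?_ _≟_ z xs
... | yes z∈xs = z∈xs
... | no z∉xs = contradiction n≤|xs| (<⇒≱ (∉⇒length< u z∉xs))

length<⇒∃∉ : (xs : List (Fin n)) → length xs < n → ∃ λ z → z ∉ xs
length<⇒∃∉ {n} xs |xs|<n with all? (λ z → DecMembership._∈?_ _≟_ z xs)
... | yes all∈ = contradiction n≤|xs| (<⇒≱ |xs|<n)
  where
  n≤|xs| : n ≤ length xs
  n≤|xs| = subst (_≤ length xs) (length-tabulate id)
    (unique⊆⇒length≤ (Unique.allFin⁺ n) (λ {z} _ → all∈ z))
... | no ¬all∈ = ¬∀⟶∃¬ n _ (λ z → DecMembership._∈?_ _≟_ z xs) ¬all∈

count≡length∘filter : {A : Set} (p : A → Bool) (xs : List A) → count p xs ≡ length (filter (T? ∘ p) xs)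
count≡length∘filter p [] = refl
count≡length∘filter p (x ∷ xs) with p x
... | true = cong suc (count≡length∘filter p xs)
... | false = count≡length∘filter p xs

does≡true⇔ : {A : Set} (a? : Dec A) → does a? ≡ true ⇔ A
does≡true⇔ (yes a) = mk⇔ (λ _ → a) (λ _ → refl)
does≡true⇔ (no ¬a) = mk⇔ (λ ()) (λ a → contradiction a ¬a)

SameEdge : Fin n × Fin n → Fin n × Fin n → Set
SameEdge p q = p ≡ q ⊎ p ≡ swap q

SameEdge? : (p q : Fin n × Fin n) → Dec (SameEdge p q)
SameEdge? p q = ≡-dec _≟_ _≟_ p q ⊎-dec ≡-dec _≟_ _≟_ p (swap q)

SameEdge-sym : {p q : Fin n × Fin n} → SameEdge p q → SameEdge q p
SameEdge-sym (inj₁ refl) = inj₁ refl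
SameEdge-sym (inj₂ refl) = inj₂ refl

SameEdge-trans : {p q r : Fin n × Fin n} → SameEdge p q → SameEdge q r → SameEdge p r
SameEdge-trans (inj₁ refl) q~r = q~r
SameEdge-trans (inj₂ refl) (inj₁ refl) = inj₂ refl
SameEdge-trans (inj₂ refl) (inj₂ refl) = inj₁ refl

SameEdge-swap : {p q : Fin n × Fin n} → SameEdge p q → SameEdge (swap p) q
SameEdge-swap (inj₁ refl) = inj₂ refl
SameEdge-swap (inj₂ refl) = inj₁ refl

¬SameEdge-fstˡ : {x y u v : Fin n} → x ≢ u → x ≢ v → ¬ SameEdge (x , y) (u , v)
¬SameEdge-fstˡ x≢u _ (inj₁ refl) = x≢u refl
¬SameEdge-fstˡ _ x≢v (inj₂ refl) = x≢v refl

¬SameEdge-fstʳ : {x y u v : Fin n} → x ≢ u → y ≢ u → ¬ SameEdge (x , y) (u , v)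
¬SameEdge-fstʳ x≢u _ (inj₁ refl) = x≢u refl
¬SameEdge-fstʳ _ y≢u (inj₂ refl) = y≢u refl

¬SameEdge-sndʳ : {x y u v : Fin n} → x ≢ v → y ≢ v → ¬ SameEdge (x , y) (u , v)
¬SameEdge-sndʳ _ y≢v (inj₁ refl) = y≢v refl
¬SameEdge-sndʳ x≢v _ (inj₂ refl) = x≢v refl

-- fill counts an unordered pair through its representative with the smaller endpoint first.
normalise : Fin n × Fin n → Fin n × Fin n
normalise (x , y) = if toℕ x <ᵇ toℕ y then (x , y) else (y , x)

normalise-SameEdge : (p : Fin n × Fin n) → SameEdge (normalise p) p
normalise-SameEdge (x , y) with toℕ x <ᵇ toℕ y
... | true = inj₁ refl
... | false = inj₂ refl

normalise-≡⇒SameEdge : {p q : Fin n × Fin n} → normalise p ≡ normalise q → SameEdge p q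
normalise-≡⇒SameEdge {p = p} {q} eq =
  SameEdge-trans (SameEdge-sym (normalise-SameEdge p))
    (subst (λ r → SameEdge r q) (sym eq) (normalise-SameEdge q))

normalise-ordered : {u v : Fin n} → toℕ u < toℕ v → (q : Fin n × Fin n) → SameEdge (u , v) q →
  normalise q ≡ (u , v)
normalise-ordered {u = u} {v} u<v _ (inj₁ refl) with toℕ u <ᵇ toℕ v | <⇒<ᵇ u<v
... | true | _ = refl
normalise-ordered {u = u} {v} u<v _ (inj₂ refl) with toℕ v <ᵇ toℕ u in v<ᵇu
... | true = contradiction (<ᵇ⇒< (toℕ v) (toℕ u) (subst T (sym v<ᵇu) _)) (<-asym u<v)
... | false = refl

∈-pairs : (p : Fin n × Fin n) → p ∈ pairs n
∈-pairs (u , v) = ∈-concat⁺′ (∈-map⁺ (u ,_) (∈-allFin v)) (∈-map⁺ _ (∈-allFin u))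

concatMap-pairs≡cartesianProduct : {A B : Set} (xs : List A) (ys : List B) →
  concatMap (λ x → map (x ,_) ys) xs ≡ cartesianProduct xs ys
concatMap-pairs≡cartesianProduct [] ys = refl
concatMap-pairs≡cartesianProduct (x ∷ xs) ys =
  cong (map (x ,_) ys ++_) (concatMap-pairs≡cartesianProduct xs ys)

pairs-unique : ∀ n → Unique (pairs n)
pairs-unique n = subst Unique (sym (concatMap-pairs≡cartesianProduct (allFin n) (allFin n)))
  (Unique.cartesianProduct⁺ (Unique.allFin⁺ n) (Unique.allFin⁺ n))

module _ {n : ℕ} (H : Graph n) where

  E-sym : {u v : Fin n} → E H u v → E H v u
  E-sym {u} {v} e = trans (Graph.sym H v u) e

  ¬E-sym : {u v : Fin n} → ¬ E H u v → ¬ E H v u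
  ¬E-sym ¬e = ¬e ∘ E-sym

  E⇒≢ : {u v : Fin n} → E H u v → u ≢ v
  E⇒≢ {u} e refl = contradiction (trans (sym e) (Graph.irrefl H u)) λ ()

  E? : (u v : Fin n) → Dec (E H u v)
  E? u v = adj H u v Bool.≟ true

isFill : Graph n → Graph n → Fin n × Fin n → Bool
isFill G H (u , v) = (toℕ u <ᵇ toℕ v) ∧ adj H u v ∧ not (adj G u v)

FillEdge : Graph n → Graph n → Fin n × Fin n → Set
FillEdge G H (x , y) = x ≢ y × E H x y × ¬ E G x y

module _ {n : ℕ} (G H : Graph n) where

  isFill-intro : {x y : Fin n} → toℕ x < toℕ y → E H x y → ¬ E G x y → T (isFill G H (x , y))
  isFill-intro x<y h ¬g = Equivalence.from T-∧
    (<⇒<ᵇ x<y , Equivalence.from T-∧ (Equivalence.from T-≡ h , Equivalence.from T-not-≡ (¬-not ¬g)))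

  isFill-elim : {x y : Fin n} → T (isFill G H (x , y)) → toℕ x < toℕ y × E H x y × ¬ E G x y
  isFill-elim {x} {y} t with Equivalence.to T-∧ t
  ... | x<ᵇy , rest with Equivalence.to T-∧ rest
  ...   | h , ¬g = <ᵇ⇒< (toℕ x) (toℕ y) x<ᵇy , Equivalence.to T-≡ h , λ g → subst T (cong not g) ¬g

  FillEdge⇒isFill∘normalise : (p : Fin n × Fin n) → FillEdge G H p → T (isFill G H (normalise p))
  FillEdge⇒isFill∘normalise (x , y) (x≢y , h , ¬g) with <-cmp (toℕ x) (toℕ y)
  ... | tri< x<y _ _ rewrite normalise-ordered x<y (x , y) (inj₁ refl) = isFill-intro x<y h ¬g
  ... | tri≈ _ x≡y _ = contradiction (toℕ-injective x≡y) x≢y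
  ... | tri> _ _ y<x rewrite normalise-ordered y<x (x , y) (inj₂ refl) =
    isFill-intro y<x (E-sym H h) (¬E-sym G ¬g)

  fill≡length-filter : fill G H ≡ length (filter (T? ∘ isFill G H) (pairs n))
  fill≡length-filter = count≡length∘filter (isFill G H) (pairs n)

  fill-≥ : (L : List (Fin n × Fin n)) → AllPairs (λ p q → ¬ SameEdge p q) L → All (FillEdge G H) L →
    length L ≤ fill G H
  fill-≥ L distinct fills = begin
    length L                                      ≡⟨ sym (length-map normalise L) ⟩
    length (map normalise L)                      ≤⟨ unique⊆⇒length≤ unique normalised-fill ⟩
    length (filter (T? ∘ isFill G H) (pairs n))   ≡⟨ sym fill≡length-filter ⟩
    fill G H                                      ∎
    where
    open ≤-Reasoning
    unique : Unique (map normalise L)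
    unique = AllPairs.map⁺ (AllPairs.map (λ ¬same → ¬same ∘ normalise-≡⇒SameEdge) distinct)
    normalised-fill : map normalise L ⊆ filter (T? ∘ isFill G H) (pairs n)
    normalised-fill x∈ with ∈-map⁻ normalise x∈
    ... | p , p∈L , refl =
      ∈-filter⁺ (T? ∘ isFill G H) (∈-pairs _) (FillEdge⇒isFill∘normalise p (All.lookup fills p∈L))

  fill-≤ : (L : List (Fin n × Fin n)) → (∀ {u v} → E H u v → ¬ E G u v → Any (SameEdge (u , v)) L) →
    fill G H ≤ length L
  fill-≤ L covers = begin
    fill G H                                      ≡⟨ fill≡length-filter ⟩
    length (filter (T? ∘ isFill G H) (pairs n))   ≤⟨ unique⊆⇒length≤ unique fill⊆normalised ⟩
    length (map normalise L)                      ≡⟨ length-map normalise L ⟩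
    length L                                      ∎
    where
    open ≤-Reasoning
    unique : Unique (filter (T? ∘ isFill G H) (pairs n))
    unique = Unique.filter⁺ (T? ∘ isFill G H) (pairs-unique n)
    fill⊆normalised : filter (T? ∘ isFill G H) (pairs n) ⊆ map normalise L
    fill⊆normalised {u , v} p∈ with isFill-elim (proj₂ (∈-filter⁻ (T? ∘ isFill G H) {xs = pairs n} p∈))
    ... | u<v , h , ¬g = Any.map⁺ (Any.map (λ {q} same → sym (normalise-ordered u<v q same)) (covers h ¬g))

  fill-≥₂ : {p q : Fin n × Fin n} → FillEdge G H p → FillEdge G H q → ¬ SameEdge p q → 2 ≤ fill G H
  fill-≥₂ {p} {q} fp fq pq = fill-≥ (p ∷ q ∷ []) ((pq ∷ []) ∷ [] ∷ []) (fp ∷ fq ∷ [])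

  fill-≥₃ : {p q r : Fin n × Fin n} → FillEdge G H p → FillEdge G H q → FillEdge G H r →
    ¬ SameEdge p q → ¬ SameEdge p r → ¬ SameEdge q r → 3 ≤ fill G H
  fill-≥₃ {p} {q} {r} fp fq fr pq pr qr =
    fill-≥ (p ∷ q ∷ r ∷ []) ((pq ∷ pr ∷ []) ∷ (qr ∷ []) ∷ [] ∷ []) (fp ∷ fq ∷ fr ∷ [])

module _ (G : Graph n) (L : List (Fin n × Fin n)) where

  AddedEdge : Fin n → Fin n → Set
  AddedEdge u v = E G u v ⊎ (u ≢ v × Any (SameEdge (u , v)) L)

  AddedEdge? : (u v : Fin n) → Dec (AddedEdge u v)
  AddedEdge? u v = E? G u v ⊎-dec (¬? (u ≟ v) ×-dec Any.any? (SameEdge? (u , v)) L)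

  AddedEdge-sym : {u v : Fin n} → AddedEdge u v → AddedEdge v u
  AddedEdge-sym (inj₁ e) = inj₁ (E-sym G e)
  AddedEdge-sym (inj₂ (u≢v , same)) = inj₂ (u≢v ∘ sym , Any.map SameEdge-swap same)

  AddedEdge-irrefl : {u : Fin n} → ¬ AddedEdge u u
  AddedEdge-irrefl (inj₁ e) = E⇒≢ G e refl
  AddedEdge-irrefl (inj₂ (u≢u , _)) = u≢u refl

addEdges : Graph n → List (Fin n × Fin n) → Graph n
addEdges G L = record
  { adj = λ u v → does (AddedEdge? G L u v)
  ; sym = λ u v → does-⇔ (mk⇔ (AddedEdge-sym G L) (AddedEdge-sym G L)) (AddedEdge? G L u v) (AddedEdge? G L v u)
  ; irrefl = λ u → dec-false (AddedEdge? G L u u) (AddedEdge-irrefl G L)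
  }

NonEdge : Graph n → Fin n × Fin n → Set
NonEdge G (x , y) = x ≢ y × ¬ E G x y

module _ (G : Graph n) (L : List (Fin n × Fin n)) where

  E-addEdges : {u v : Fin n} → E (addEdges G L) u v ⇔ AddedEdge G L u v
  E-addEdges {u} {v} = does≡true⇔ (AddedEdge? G L u v)

  addEdges-⊇ : {u v : Fin n} → E G u v → E (addEdges G L) u v
  addEdges-⊇ = Equivalence.from E-addEdges ∘ inj₁

  addEdges-added : {u v : Fin n} → u ≢ v → Any (SameEdge (u , v)) L → E (addEdges G L) u v
  addEdges-added u≢v same = Equivalence.from E-addEdges (inj₂ (u≢v , same))

  addEdges-agree : {u v : Fin n} → ¬ Any (SameEdge (u , v)) L → E (addEdges G L) u v ⇔ E G u v
  addEdges-agree {u} {v} ¬same = mk⇔ old addEdges-⊇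
    where
    old : E (addEdges G L) u v → E G u v
    old e with Equivalence.to E-addEdges e
    ... | inj₁ g = g
    ... | inj₂ (_ , same) = contradiction same ¬same

  fill-addEdges : AllPairs (λ p q → ¬ SameEdge p q) L → All (NonEdge G) L → fill G (addEdges G L) ≡ length L
  fill-addEdges distinct nonEdges =
    ≤-antisym (fill-≤ G (addEdges G L) L new) (fill-≥ G (addEdges G L) L distinct (All.tabulate added))
    where
    new : ∀ {u v} → E (addEdges G L) u v → ¬ E G u v → Any (SameEdge (u , v)) L
    new e ¬g with Equivalence.to E-addEdges e
    ... | inj₁ g = contradiction g ¬g
    ... | inj₂ (_ , same) = same
    added : ∀ {p} → p ∈ L → FillEdge G (addEdges G L) p
    added {x , y} p∈L with All.lookup nonEdges p∈L
    ... | x≢y , ¬g = x≢y , addEdges-added x≢y (Any.map inj₁ p∈L) , ¬g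

-- Induced P4s

module _ {n : ℕ} (H : Graph n) where

  IsP4-reverse : {a b c d : Fin n} → IsP4 H a b c d → IsP4 H d c b a
  IsP4-reverse (ab , bc , cd , ¬ac , ¬bd , ¬ad) =
    E-sym H cd , E-sym H bc , E-sym H ab , ¬E-sym H ¬bd , ¬E-sym H ¬ac , ¬E-sym H ¬ad

  IsP4-unique : {a b c d : Fin n} → IsP4 H a b c d → Unique (a ∷ b ∷ c ∷ d ∷ [])
  IsP4-unique (ab , bc , cd , ¬ac , ¬bd , ¬ad) =
    (E⇒≢ H ab ∷ (λ { refl → ¬ad cd }) ∷ (λ { refl → ¬bd (E-sym H ab) }) ∷ []) ∷
    (E⇒≢ H bc ∷ (λ { refl → ¬ad ab }) ∷ []) ∷
    (E⇒≢ H cd ∷ []) ∷ [] ∷ []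

  Dominates : Fin n → Fin n → Set
  Dominates u w = ∀ z → z ≢ u → z ≢ w → E H u z

  dominating-pair-∉P4-start : {u w a b c d : Fin n} → Dominates u w → Dominates w u → IsP4 H a b c d →
    a ≢ u × b ≢ u
  dominating-pair-∉P4-start {u} {w} {a} {b} {c} {d} u⊳ w⊳ P@(ab , bc , cd , ¬ac , ¬bd , ¬ad)
    with IsP4-unique P
  ... | (a≢b ∷ a≢c ∷ a≢d ∷ []) ∷ (b≢c ∷ b≢d ∷ []) ∷ (c≢d ∷ []) ∷ [] ∷ [] = a≢u , b≢u
    where
    a≢u : a ≢ u
    a≢u refl with c ≟ w | d ≟ w
    ... | no c≢w | _ = ¬ac (u⊳ c (a≢c ∘ sym) c≢w)
    ... | yes _ | no d≢w = ¬ad (u⊳ d (a≢d ∘ sym) d≢w)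
    ... | yes refl | yes refl = c≢d refl
    b≢u : b ≢ u
    b≢u refl with d ≟ w
    ... | no d≢w = ¬bd (u⊳ d (b≢d ∘ sym) d≢w)
    ... | yes refl = ¬ad (E-sym H (w⊳ a a≢d a≢b))

  dominating-pair-∉P4 : {u w a b c d : Fin n} → Dominates u w → Dominates w u → IsP4 H a b c d →
    All (_≢ u) (a ∷ b ∷ c ∷ d ∷ [])
  dominating-pair-∉P4 u⊳ w⊳ P
    with dominating-pair-∉P4-start u⊳ w⊳ P | dominating-pair-∉P4-start u⊳ w⊳ (IsP4-reverse P)
  ... | a≢u , b≢u | d≢u , c≢u = a≢u ∷ b≢u ∷ c≢u ∷ d≢u ∷ []

  Separates : Fin n → Fin n → Fin n → Set
  Separates z x y = z ≢ x × z ≢ y × E H z x × ¬ E H z y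

  Separated : Fin n → Fin n → Set
  Separated x y = ∃ λ z → Separates z x y ⊎ Separates z y x

  Twins : Fin n → Fin n → Set
  Twins u w = ∀ z → z ≢ u → z ≢ w → E H z u ⇔ E H z w

  twins-¬Separated : {x y u w : Fin n} → Twins u w → Separated x y → ¬ SameEdge (x , y) (u , w)
  twins-¬Separated twins (z , inj₁ (z≢x , z≢y , zx , ¬zy)) (inj₁ refl) =
    ¬zy (Equivalence.to (twins z z≢x z≢y) zx)
  twins-¬Separated twins (z , inj₂ (z≢y , z≢x , zy , ¬zx)) (inj₁ refl) =
    ¬zx (Equivalence.from (twins z z≢x z≢y) zy)
  twins-¬Separated twins (z , inj₁ (z≢x , z≢y , zx , ¬zy)) (inj₂ refl) =
    ¬zy (Equivalence.from (twins z z≢y z≢x) zx)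
  twins-¬Separated twins (z , inj₂ (z≢y , z≢x , zy , ¬zx)) (inj₂ refl) =
    ¬zx (Equivalence.to (twins z z≢y z≢x) zy)

module _ {n : ℕ} (G H : Graph n) where

  -- Any two vertices of a P4 are separated by a third one, so only separated pairs matter.
  IsP4-transfer : (P : Fin n → Set) → (∀ {x y} → P x → P y → Separated H x y → E H x y ⇔ E G x y) →
    {a b c d : Fin n} → IsP4 H a b c d → All P (a ∷ b ∷ c ∷ d ∷ []) → IsP4 G a b c d
  IsP4-transfer P agree {a} {b} {c} {d} p4@(ab , bc , cd , ¬ac , ¬bd , ¬ad) (pa ∷ pb ∷ pc ∷ pd ∷ [])
    with IsP4-unique H p4
  ... | (a≢b ∷ a≢c ∷ a≢d ∷ []) ∷ (b≢c ∷ b≢d ∷ []) ∷ (c≢d ∷ []) ∷ [] ∷ [] =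
    to pa pb ab-sep ab , to pb pc bc-sep bc , to pc pd cd-sep cd ,
    ¬to pa pc ac-sep ¬ac , ¬to pb pd bd-sep ¬bd , ¬to pa pd ad-sep ¬ad
    where
    to : ∀ {x y} → P x → P y → Separated H x y → E H x y → E G x y
    to px py sep = Equivalence.to (agree px py sep)
    ¬to : ∀ {x y} → P x → P y → Separated H x y → ¬ E H x y → ¬ E G x y
    ¬to px py sep ¬h = ¬h ∘ Equivalence.from (agree px py sep)
    ab-sep : Separated H a b
    ab-sep = _ , inj₂ (b≢c ∘ sym , a≢c ∘ sym , E-sym H bc , ¬E-sym H ¬ac)
    bc-sep : Separated H b c
    bc-sep = _ , inj₁ (a≢b , a≢c , ab , ¬ac)
    cd-sep : Separated H c d
    cd-sep = _ , inj₁ (b≢c , b≢d , bc , ¬bd)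
    ac-sep : Separated H a c
    ac-sep = _ , inj₂ (c≢d ∘ sym , a≢d ∘ sym , E-sym H cd , ¬E-sym H ¬ad)
    bd-sep : Separated H b d
    bd-sep = _ , inj₁ (a≢b , a≢d , ab , ¬ad)
    ad-sep : Separated H a d
    ad-sep = _ , inj₁ (a≢b ∘ sym , b≢d , E-sym H ab , ¬bd)

  P4⊆⇒P4Sparse : (∀ {a b c d} → IsP4 H a b c d → IsP4 G a b c d) → P4Sparse G → P4Sparse H
  P4⊆⇒P4Sparse P4⊆ sparse v v-inj a b c d a′ b′ c′ d′ P Q =
    sparse v v-inj a b c d a′ b′ c′ d′ (P4⊆ P) (P4⊆ Q)

P4Sparse-five : (H : Graph n) → P4Sparse H → (xs : Vec (Fin n) 5) → Vec.Unique xs →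
  (a b c d a′ b′ c′ d′ x : Fin 5) →
  IsP4 H (Vec.lookup xs a) (Vec.lookup xs b) (Vec.lookup xs c) (Vec.lookup xs d) →
  IsP4 H (Vec.lookup xs a′) (Vec.lookup xs b′) (Vec.lookup xs c′) (Vec.lookup xs d′) →
  x ∈ (a ∷ b ∷ c ∷ d ∷ []) → x ∉ (a′ ∷ b′ ∷ c′ ∷ d′ ∷ []) → ⊥
P4Sparse-five H sparse xs distinct a b c d a′ b′ c′ d′ x P Q x∈ =
  contradiction (proj₁ (sparse (Vec.lookup xs) (Vec.lookup-injective distinct _ _) a b c d a′ b′ c′ d′ P Q) x x∈)

-- Thick spiders

module ThickSpiderProperties {n k : ℕ} {G : Graph n} (T : ThickSpider G k) where
  open ThickSpider T

  s≢s : {i j : Fin k} → i ≢ j → s i ≢ s j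
  s≢s i≢j = i≢j ∘ s-inj

  c≢c : {i j : Fin k} → i ≢ j → c i ≢ c j
  c≢c i≢j = i≢j ∘ c-inj

  s≢c : {i j : Fin k} → s i ≢ c j
  s≢c {i} {j} = disjoint i j

  c≢s : {i j : Fin k} → c i ≢ s j
  c≢s {i} {j} = disjoint j i ∘ sym

  s≁s : {i j : Fin k} → ¬ E G (s i) (s j)
  s≁s {i} {j} = S-indep i j

  s~c : {i j : Fin k} → i ≢ j → E G (s i) (c j)
  s~c {i} {j} = proj₂ (S-K-adj i j)

  s≁c : {i : Fin k} → ¬ E G (s i) (c i)
  s≁c {i} e = proj₁ (S-K-adj i i) e refl

  c~c : {i j : Fin k} → i ≢ j → E G (c i) (c j)
  c~c {i} {j} = K-clique i j

  InR : Fin n → Set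
  InR z = (∀ l → z ≢ s l) × (∀ l → z ≢ c l)

  r~c : {z : Fin n} → InR z → (l : Fin k) → E G z (c l)
  r~c (≢s , ≢c) = proj₁ (R-adj _ ≢s ≢c)

  r≁s : {z : Fin n} → InR z → (l : Fin k) → ¬ E G z (s l)
  r≁s (≢s , ≢c) = proj₂ (R-adj _ ≢s ≢c)

  vertex-cases : (z : Fin n) → (∃ λ l → z ≡ s l) ⊎ (∃ λ l → z ≡ c l) ⊎ InR z
  vertex-cases z with any? (λ l → z ≟ s l) | any? (λ l → z ≟ c l)
  ... | yes z∈S | _ = inj₁ z∈S
  ... | no _ | yes z∈K = inj₂ (inj₁ z∈K)
  ... | no z∉S | no z∉K = inj₂ (inj₂ ((λ l eq → z∉S (l , eq)) , (λ l eq → z∉K (l , eq))))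

  S∪K : List (Fin n)
  S∪K = tabulate s ++ tabulate c

  length-S∪K : length S∪K ≡ k + k
  length-S∪K = trans (length-++ (tabulate s)) (cong₂ _+_ (length-tabulate s) (length-tabulate c))

  S∪K-unique : Unique S∪K
  S∪K-unique = Unique.++⁺ (Unique.tabulate⁺ s-inj) (Unique.tabulate⁺ c-inj) S∩K≡∅
    where
    S∩K≡∅ : ∀ {z} → ¬ (z ∈ tabulate s × z ∈ tabulate c)
    S∩K≡∅ (z∈S , z∈K) with ∈-tabulate⁻ z∈S | ∈-tabulate⁻ z∈K
    ... | i , refl | j , si≡cj = disjoint i j si≡cj

  InR⇒∉S∪K : {z : Fin n} → InR z → z ∉ S∪K
  InR⇒∉S∪K (≢s , ≢c) z∈ with ∈-++⁻ (tabulate s) z∈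
  ... | inj₁ z∈S = ≢s _ (proj₂ (∈-tabulate⁻ z∈S))
  ... | inj₂ z∈K = ≢c _ (proj₂ (∈-tabulate⁻ z∈K))

  ∉S∪K⇒InR : {z : Fin n} → z ∉ S∪K → InR z
  ∉S∪K⇒InR z∉ = (λ { l refl → z∉ (∈-++⁺ˡ (∈-tabulate⁺ l)) })
               , (λ { l refl → z∉ (∈-++⁺ʳ (tabulate s) (∈-tabulate⁺ l)) })

  k+k≤n : k + k ≤ n
  k+k≤n = subst (_≤ n) length-S∪K (unique⇒length≤ S∪K-unique)

  InR⇒k+k<n : {z : Fin n} → InR z → k + k < n
  InR⇒k+k<n r = subst (_< n) length-S∪K (∉⇒length< S∪K-unique (InR⇒∉S∪K r))

  n∸k≡3⇒k≤3 : n ∸ k ≡ 3 → k ≤ 3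
  n∸k≡3⇒k≤3 eq = subst (k ≤_) eq (m+n≤o⇒m≤o∸n k k+k≤n)

  n∸k≡3⇒¬InR : n ∸ k ≡ 3 → 3 ≤ k → (z : Fin n) → ¬ InR z
  n∸k≡3⇒¬InR eq 3≤k z r = <⇒≱ (subst (k <_) eq (m+n≤o⇒m≤o∸n (suc k) (InR⇒k+k<n r))) 3≤k

  4≤n∸k⇒S∪K-short : 4 ≤ n ∸ k → k ≤ 3 → length S∪K < n
  4≤n∸k⇒S∪K-short 4≤n∸k k≤3 = subst (_< n) (sym length-S∪K) (≤-trans (s≤s (+-monoˡ-≤ k k≤3)) 4+k≤n)
    where
    4+k≤n : 4 + k ≤ n
    4+k≤n = m≤o∸n⇒m+n≤o 4 (≤-trans (m≤m+n k k) k+k≤n) 4≤n∸k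

  4≤n∸k⇒outsider : 4 ≤ n ∸ k → (i j m : Fin k) →
    ∃ λ w → E G w (c i) × E G w (c j) × ¬ E G w (s i) × ¬ E G w (s j) × w ≢ s m
  4≤n∸k⇒outsider 4≤n∸k i j m with 3 <? k
  ... | yes 3<k with length<⇒∃∉ (i ∷ j ∷ m ∷ []) 3<k
  ...   | l , l∉ =
    s l , s~c (l∉ ∘ here) , s~c (l∉ ∘ there ∘ here) , s≁s , s≁s , s≢s (l∉ ∘ there ∘ there ∘ here)
  4≤n∸k⇒outsider 4≤n∸k i j m | no 3≮k with length<⇒∃∉ S∪K (4≤n∸k⇒S∪K-short 4≤n∸k (≮⇒≥ 3≮k))
  ... | z , z∉ with ∉S∪K⇒InR z∉
  ...   | r@(≢s , _) = z , r~c r i , r~c r j , r≁s r i , r≁s r j , ≢s m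

  module _ (H : Graph n) (G⊆H : ∀ {u v} → E G u v → E H u v) where

    c-dominates : {l : Fin k} → Dominates H (c l) (s l)
    c-dominates {l} z z≢cl z≢sl with vertex-cases z
    ... | inj₁ (l′ , refl) = G⊆H (E-sym G (s~c (z≢sl ∘ cong s)))
    ... | inj₂ (inj₁ (l′ , refl)) = G⊆H (c~c (z≢cl ∘ cong c ∘ sym))
    ... | inj₂ (inj₂ r) = G⊆H (E-sym G (r~c r l))

    c-universal : {l : Fin k} → E H (c l) (s l) → Dominates H (c l) (c l)
    c-universal {l} cl~sl z z≢cl _ with z ≟ s l
    ... | yes refl = cl~sl
    ... | no z≢sl = c-dominates z z≢cl z≢sl

    c~s : {l′ : Fin k} → E H (c l′) (s l′) → (l : Fin k) → E H (c l) (s l′)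
    c~s {l′} cl′~sl′ l with l ≟ l′
    ... | yes refl = cl′~sl′
    ... | no l≢l′ = c-dominates (s l′) s≢c (s≢s (l≢l′ ∘ sym))

-- Optimal solutions

module SpiderSolutions {n k : ℕ} {G : Graph n} (sparse : P4Sparse G) (T : ThickSpider G k)
  {i j : Fin k} (i≢j : i ≢ j) where
  open ThickSpider T
  open ThickSpiderProperties T

  module Fill₃ where
    L₃ : List (Fin n × Fin n)
    L₃ = (s i , s j) ∷ (s i , c i) ∷ (s j , c j) ∷ []

    H₃ : Graph n
    H₃ = addEdges G L₃

    G⊆H₃ : ∀ {u v} → E G u v → E H₃ u v
    G⊆H₃ = addEdges-⊇ G L₃

    ci~si : E H₃ (c i) (s i)
    ci~si = addEdges-added G L₃ c≢s (there (here (inj₂ refl)))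

    cj~sj : E H₃ (c j) (s j)
    cj~sj = addEdges-added G L₃ c≢s (there (there (here (inj₂ refl))))

    ¬E-H₃ : {z y : Fin n} → z ≢ s i → z ≢ s j → z ≢ c i → z ≢ c j → ¬ E G z y → ¬ E H₃ z y
    ¬E-H₃ z≢si z≢sj z≢ci z≢cj ¬g = ¬g ∘ Equivalence.to (addEdges-agree G L₃ (All¬⇒¬Any
      (¬SameEdge-fstˡ z≢si z≢sj ∷ ¬SameEdge-fstˡ z≢si z≢ci ∷ ¬SameEdge-fstˡ z≢sj z≢cj ∷ [])))

    ¬E-H₃-both : {z : Fin n} → z ≢ s i → z ≢ s j → z ≢ c i → z ≢ c j →
      ¬ E G z (s i) → ¬ E G z (s j) → E H₃ z (s i) ⇔ E H₃ z (s j)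
    ¬E-H₃-both z≢si z≢sj z≢ci z≢cj ¬zsi ¬zsj =
      mk⇔ (⊥-elim ∘ ¬E-H₃ z≢si z≢sj z≢ci z≢cj ¬zsi) (⊥-elim ∘ ¬E-H₃ z≢si z≢sj z≢ci z≢cj ¬zsj)

    s-twins : Twins H₃ (s i) (s j)
    s-twins z z≢si z≢sj with vertex-cases z
    ... | inj₁ (l , refl) = ¬E-H₃-both z≢si z≢sj s≢c s≢c s≁s s≁s
    ... | inj₂ (inj₁ (l , refl)) = mk⇔ (λ _ → c~s H₃ G⊆H₃ cj~sj l) (λ _ → c~s H₃ G⊆H₃ ci~si l)
    ... | inj₂ (inj₂ r@(_ , ≢c)) = ¬E-H₃-both z≢si z≢sj (≢c i) (≢c j) (r≁s r i) (r≁s r j)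

    P4-H₃⇒P4-G : ∀ {p q r t} → IsP4 H₃ p q r t → IsP4 G p q r t
    P4-H₃⇒P4-G P = IsP4-transfer G H₃ (λ x → x ≢ c i × x ≢ c j) agree P
      (All.zip ( dominating-pair-∉P4 H₃ ci-universal ci-universal P
               , dominating-pair-∉P4 H₃ cj-universal cj-universal P))
      where
      ci-universal : Dominates H₃ (c i) (c i)
      ci-universal = c-universal H₃ G⊆H₃ ci~si
      cj-universal : Dominates H₃ (c j) (c j)
      cj-universal = c-universal H₃ G⊆H₃ cj~sj
      agree : ∀ {x y} → x ≢ c i × x ≢ c j → y ≢ c i × y ≢ c j → Separated H₃ x y → E H₃ x y ⇔ E G x y
      agree (x≢ci , x≢cj) (y≢ci , y≢cj) sep = addEdges-agree G L₃ (All¬⇒¬Any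
        (twins-¬Separated H₃ s-twins sep ∷ ¬SameEdge-sndʳ x≢ci y≢ci ∷ ¬SameEdge-sndʳ x≢cj y≢cj ∷ []))

    solution : Solution G (s i) (s j) H₃
    solution = P4⊆⇒P4Sparse G H₃ P4-H₃⇒P4-G sparse , (λ _ _ → G⊆H₃) ,
      addEdges-added G L₃ (s≢s i≢j) (here (inj₁ refl))

    fill≡3 : fill G H₃ ≡ 3
    fill≡3 = fill-addEdges G L₃
      ( (¬SameEdge-sndʳ s≢c s≢c ∷ ¬SameEdge-sndʳ s≢c s≢c ∷ [])
      ∷ (¬SameEdge-sndʳ s≢c (c≢c i≢j) ∷ []) ∷ [] ∷ [])
      ((s≢s i≢j , s≁s) ∷ (s≢c , s≁c) ∷ (s≢c , s≁c) ∷ [])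

  module Fill₂ {m : Fin k} (i≢m : i ≢ m) (j≢m : j ≢ m)
    (R-empty : ∀ z → ¬ InR z) (indices : ∀ l → l ∈ (i ∷ j ∷ m ∷ [])) where

    L₂ : List (Fin n × Fin n)
    L₂ = (s i , s j) ∷ (s i , s m) ∷ []

    H₂ : Graph n
    H₂ = addEdges G L₂

    G⊆H₂ : ∀ {u v} → E G u v → E H₂ u v
    G⊆H₂ = addEdges-⊇ G L₂

    si-dominates : Dominates H₂ (s i) (c i)
    si-dominates z z≢si z≢ci with vertex-cases z
    ... | inj₁ (l , refl) with indices l
    ...   | here refl = contradiction refl z≢si
    ...   | there (here refl) = addEdges-added G L₂ (s≢s i≢j) (here (inj₁ refl))
    ...   | there (there (here refl)) = addEdges-added G L₂ (s≢s i≢m) (there (here (inj₁ refl)))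
    si-dominates z z≢si z≢ci | inj₂ (inj₁ (l , refl)) = G⊆H₂ (s~c (z≢ci ∘ cong c ∘ sym))
    si-dominates z z≢si z≢ci | inj₂ (inj₂ r) = contradiction r (R-empty z)

    P4-H₂⇒P4-G : ∀ {p q r t} → IsP4 H₂ p q r t → IsP4 G p q r t
    P4-H₂⇒P4-G P = IsP4-transfer G H₂ (_≢ s i) agree P
      (dominating-pair-∉P4 H₂ si-dominates (c-dominates H₂ G⊆H₂) P)
      where
      agree : ∀ {x y} → x ≢ s i → y ≢ s i → Separated H₂ x y → E H₂ x y ⇔ E G x y
      agree x≢si y≢si _ = addEdges-agree G L₂ (All¬⇒¬Any
        (¬SameEdge-fstʳ x≢si y≢si ∷ ¬SameEdge-fstʳ x≢si y≢si ∷ []))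

    solution : Solution G (s i) (s j) H₂
    solution = P4⊆⇒P4Sparse G H₂ P4-H₂⇒P4-G sparse , (λ _ _ → G⊆H₂) ,
      addEdges-added G L₂ (s≢s i≢j) (here (inj₁ refl))

    fill≡2 : fill G H₂ ≡ 2
    fill≡2 = fill-addEdges G L₂ ((¬SameEdge-sndʳ (s≢s i≢m) (s≢s j≢m) ∷ []) ∷ [] ∷ [])
      ((s≢s i≢j , s≁s) ∷ (s≢s i≢m , s≁s) ∷ [])

-- Lower bounds

module SpiderLowerBounds {n k : ℕ} {G : Graph n} (T : ThickSpider G k)
  (H : Graph n) (sparse : P4Sparse H) (G⊆H : ∀ {u v} → E G u v → E H u v) where
  open ThickSpider T
  open ThickSpiderProperties T

  module Oriented {i j m : Fin k} (i≢j : i ≢ j) (i≢m : i ≢ m) (j≢m : j ≢ m) (si~sj : E H (s i) (s j)) where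

    -- Otherwise w – c i – s j – s i and w – c j – s i – s j are two P4s on five vertices.
    fan : {w : Fin n} → E G w (c i) → E G w (c j) →
      E H (s i) w ⊎ E H (s j) w ⊎ E H (s i) (c i) ⊎ E H (s j) (c j)
    fan {w} w~ci w~cj with E? H (s i) w | E? H (s j) w | E? H (s i) (c i) | E? H (s j) (c j)
    ... | yes e | _ | _ | _ = inj₁ e
    ... | no _ | yes e | _ | _ = inj₂ (inj₁ e)
    ... | no _ | no _ | yes e | _ = inj₂ (inj₂ (inj₁ e))
    ... | no _ | no _ | no _ | yes e = inj₂ (inj₂ (inj₂ e))
    ... | no ¬siw | no ¬sjw | no ¬sici | no ¬sjcj = ⊥-elim (P4Sparse-five H sparse
      (w ∷ c i ∷ c j ∷ s i ∷ s j ∷ []) distinct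
      (# 0) (# 1) (# 4) (# 3) (# 0) (# 2) (# 3) (# 4) (# 1)
      ( G⊆H w~ci , G⊆H (E-sym G (s~c (i≢j ∘ sym))) , E-sym H si~sj
      , ¬E-sym H ¬sjw , ¬E-sym H ¬sici , ¬E-sym H ¬siw)
      ( G⊆H w~cj , G⊆H (E-sym G (s~c i≢j)) , si~sj
      , ¬E-sym H ¬siw , ¬E-sym H ¬sjcj , ¬E-sym H ¬sjw)
      (there (here refl)) (All¬⇒¬Any ((λ ()) ∷ (λ ()) ∷ (λ ()) ∷ (λ ()) ∷ [])))
      where
      distinct : Vec.Unique (w ∷ c i ∷ c j ∷ s i ∷ s j ∷ [])
      distinct =
        (E⇒≢ G w~ci ∷ E⇒≢ G w~cj ∷ (λ { refl → s≁c w~ci }) ∷ (λ { refl → s≁c w~cj }) ∷ []) ∷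
        (c≢c i≢j ∷ c≢s ∷ c≢s ∷ []) ∷
        (c≢s ∷ c≢s ∷ []) ∷
        (s≢s i≢j ∷ []) ∷ [] ∷ []

    -- Otherwise s j – c m – c j – s m and s m – c j – s i – s j are two P4s on five vertices.
    zigzag : ¬ E H (s i) (s m) → ¬ E H (s j) (s m) → ¬ E H (s m) (c m) → E H (s j) (c j)
    zigzag ¬sism ¬sjsm ¬smcm with E? H (s j) (c j)
    ... | yes sjcj = sjcj
    ... | no ¬sjcj = ⊥-elim (P4Sparse-five H sparse
      (s i ∷ s j ∷ s m ∷ c j ∷ c m ∷ []) distinct
      (# 1) (# 4) (# 3) (# 2) (# 2) (# 3) (# 0) (# 1) (# 4)
      ( G⊆H (s~c j≢m) , G⊆H (c~c (j≢m ∘ sym)) , G⊆H (E-sym G (s~c (j≢m ∘ sym)))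
      , ¬sjcj , ¬E-sym H ¬smcm , ¬sjsm)
      ( G⊆H (s~c (j≢m ∘ sym)) , G⊆H (E-sym G (s~c i≢j)) , si~sj
      , ¬E-sym H ¬sism , ¬E-sym H ¬sjcj , ¬E-sym H ¬sjsm)
      (there (here refl)) (All¬⇒¬Any ((λ ()) ∷ (λ ()) ∷ (λ ()) ∷ (λ ()) ∷ [])))
      where
      distinct : Vec.Unique (s i ∷ s j ∷ s m ∷ c j ∷ c m ∷ [])
      distinct =
        (s≢s i≢j ∷ s≢s i≢m ∷ s≢c ∷ s≢c ∷ []) ∷
        (s≢s j≢m ∷ s≢c ∷ s≢c ∷ []) ∷
        (s≢c ∷ s≢c ∷ []) ∷
        (c≢c j≢m ∷ []) ∷ [] ∷ []

    e₀ : FillEdge G H (s i , s j)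
    e₀ = s≢s i≢j , si~sj , s≁s

    ss-fill : {l l′ : Fin k} → l ≢ l′ → E H (s l) (s l′) → FillEdge G H (s l , s l′)
    ss-fill l≢l′ e = s≢s l≢l′ , e , s≁s

    sc-fill : {l : Fin k} → E H (s l) (c l) → FillEdge G H (s l , c l)
    sc-fill e = s≢c , e , s≁c

    fill≥2 : 2 ≤ fill G H
    fill≥2 with fan (s~c (i≢m ∘ sym)) (s~c (j≢m ∘ sym))
    ... | inj₁ sism = fill-≥₂ G H e₀ (ss-fill i≢m sism) (¬SameEdge-sndʳ (s≢s i≢m) (s≢s j≢m))
    ... | inj₂ (inj₁ sjsm) = fill-≥₂ G H e₀ (ss-fill j≢m sjsm) (¬SameEdge-sndʳ (s≢s i≢m) (s≢s j≢m))
    ... | inj₂ (inj₂ (inj₁ sici)) = fill-≥₂ G H e₀ (sc-fill sici) (¬SameEdge-sndʳ s≢c s≢c)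
    ... | inj₂ (inj₂ (inj₂ sjcj)) = fill-≥₂ G H e₀ (sc-fill sjcj) (¬SameEdge-sndʳ s≢c s≢c)

    fill≥3-with-si~sm : {w : Fin n} → E G w (c i) → E G w (c j) → ¬ E G w (s i) → ¬ E G w (s j) →
      w ≢ s m → E H (s i) (s m) → 3 ≤ fill G H
    fill≥3-with-si~sm {w} w~ci w~cj w≁si w≁sj w≢sm sism = with-third (fan w~ci w~cj)
      where
      e₁ : FillEdge G H (s i , s m)
      e₁ = ss-fill i≢m sism
      w≢si : w ≢ s i
      w≢si refl = s≁c w~ci
      w≢sj : w ≢ s j
      w≢sj refl = s≁c w~cj
      sw-fill : {l : Fin k} → w ≢ s l → E H (s l) w → ¬ E G w (s l) → FillEdge G H (s l , w)
      sw-fill w≢sl e w≁sl = w≢sl ∘ sym , e , ¬E-sym G w≁sl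
      e₀≉e₁ : ¬ SameEdge (s i , s j) (s i , s m)
      e₀≉e₁ = ¬SameEdge-sndʳ (s≢s i≢m) (s≢s j≢m)
      e₀≉sw : {u : Fin n} → ¬ SameEdge (s i , s j) (u , w)
      e₀≉sw = ¬SameEdge-sndʳ (w≢si ∘ sym) (w≢sj ∘ sym)
      e₁≉sw : {u : Fin n} → ¬ SameEdge (s i , s m) (u , w)
      e₁≉sw = ¬SameEdge-sndʳ (w≢si ∘ sym) (w≢sm ∘ sym)
      with-third : E H (s i) w ⊎ E H (s j) w ⊎ E H (s i) (c i) ⊎ E H (s j) (c j) → 3 ≤ fill G H
      with-third (inj₁ siw) = fill-≥₃ G H e₀ e₁ (sw-fill w≢si siw w≁si) e₀≉e₁ e₀≉sw e₁≉sw
      with-third (inj₂ (inj₁ sjw)) = fill-≥₃ G H e₀ e₁ (sw-fill w≢sj sjw w≁sj) e₀≉e₁ e₀≉sw e₁≉sw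
      with-third (inj₂ (inj₂ (inj₁ sici))) =
        fill-≥₃ G H e₀ e₁ (sc-fill sici) e₀≉e₁ (¬SameEdge-sndʳ s≢c s≢c) (¬SameEdge-sndʳ s≢c s≢c)
      with-third (inj₂ (inj₂ (inj₂ sjcj))) =
        fill-≥₃ G H e₀ e₁ (sc-fill sjcj) e₀≉e₁ (¬SameEdge-sndʳ s≢c s≢c) (¬SameEdge-sndʳ s≢c s≢c)

    fill≥3-with-sm~cm : ¬ E H (s i) (s m) → ¬ E H (s j) (s m) → E H (s m) (c m) → 3 ≤ fill G H
    fill≥3-with-sm~cm ¬sism ¬sjsm smcm = with-third (fan (s~c (i≢m ∘ sym)) (s~c (j≢m ∘ sym)))
      where
      with-third : E H (s i) (s m) ⊎ E H (s j) (s m) ⊎ E H (s i) (c i) ⊎ E H (s j) (c j) → 3 ≤ fill G H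
      with-third (inj₁ sism) = contradiction sism ¬sism
      with-third (inj₂ (inj₁ sjsm)) = contradiction sjsm ¬sjsm
      with-third (inj₂ (inj₂ (inj₁ sici))) = fill-≥₃ G H e₀ (sc-fill smcm) (sc-fill sici)
        (¬SameEdge-sndʳ s≢c s≢c) (¬SameEdge-sndʳ s≢c s≢c) (¬SameEdge-sndʳ s≢c (c≢c (i≢m ∘ sym)))
      with-third (inj₂ (inj₂ (inj₂ sjcj))) = fill-≥₃ G H e₀ (sc-fill smcm) (sc-fill sjcj)
        (¬SameEdge-sndʳ s≢c s≢c) (¬SameEdge-sndʳ s≢c s≢c) (¬SameEdge-sndʳ s≢c (c≢c (j≢m ∘ sym)))

  module _ {i j m : Fin k} (i≢j : i ≢ j) (i≢m : i ≢ m) (j≢m : j ≢ m) (si~sj : E H (s i) (s j)) where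
    private
      module O = Oriented i≢j i≢m j≢m si~sj
      module O′ = Oriented (i≢j ∘ sym) j≢m i≢m (E-sym H si~sj)

    fill≥2 : 2 ≤ fill G H
    fill≥2 = O.fill≥2

    fill≥3 : {w : Fin n} → E G w (c i) → E G w (c j) → ¬ E G w (s i) → ¬ E G w (s j) → w ≢ s m →
      3 ≤ fill G H
    fill≥3 w~ci w~cj w≁si w≁sj w≢sm with E? H (s i) (s m) | E? H (s j) (s m) | E? H (s m) (c m)
    ... | yes sism | _ | _ = O.fill≥3-with-si~sm w~ci w~cj w≁si w≁sj w≢sm sism
    ... | no _ | yes sjsm | _ = O′.fill≥3-with-si~sm w~cj w~ci w≁sj w≁si w≢sm sjsm
    ... | no ¬sism | no ¬sjsm | yes smcm = O.fill≥3-with-sm~cm ¬sism ¬sjsm smcm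
    ... | no ¬sism | no ¬sjsm | no ¬smcm =
      fill-≥₃ G H O.e₀ (O.sc-fill (O′.zigzag ¬sjsm ¬sism ¬smcm)) (O.sc-fill (O.zigzag ¬sism ¬sjsm ¬smcm))
        (¬SameEdge-sndʳ s≢c s≢c) (¬SameEdge-sndʳ s≢c s≢c) (¬SameEdge-sndʳ s≢c (c≢c i≢j))

lemma15 : ∀ {n k : ℕ} (G : Graph n) → P4Sparse G → (T : ThickSpider G k) → 3 ≤ k →
    (i j : Fin k) → i ≢ j →
    ¬ E G (ThickSpider.s T i) (ThickSpider.s T j) →
    ((n ∸ k ≡ 3 → HasOptimalWith G (ThickSpider.s T i) (ThickSpider.s T j) 2) ×
     (4 ≤ n ∸ k → HasOptimalWith G (ThickSpider.s T i) (ThickSpider.s T j) 3))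
lemma15 {n} {k} G sparse T 3≤k i j i≢j _ with length<⇒∃∉ (i ∷ j ∷ []) 3≤k
... | m , m∉ = optimal₂ , optimal₃
  where
  open ThickSpider T
  open ThickSpiderProperties T
  open SpiderSolutions sparse T i≢j
  open SpiderLowerBounds T
  i≢m : i ≢ m
  i≢m = m∉ ∘ here ∘ sym
  j≢m : j ≢ m
  j≢m = m∉ ∘ there ∘ here ∘ sym

  optimal₂ : n ∸ k ≡ 3 → HasOptimalWith G (s i) (s j) 2
  optimal₂ n∸k≡3 = H₂ , solution , fill≡2 ,
    λ { H (sparseH , G⊆H , si~sj) → fill≥2 H sparseH (G⊆H _ _) i≢j i≢m j≢m si~sj }
    where
    open Fill₂ i≢m j≢m (n∸k≡3⇒¬InR n∸k≡3 3≤k)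
      (unique∧n≤length⇒∈ ((i≢j ∷ i≢m ∷ []) ∷ (j≢m ∷ []) ∷ [] ∷ []) (n∸k≡3⇒k≤3 n∸k≡3))

  optimal₃ : 4 ≤ n ∸ k → HasOptimalWith G (s i) (s j) 3
  optimal₃ 4≤n∸k with 4≤n∸k⇒outsider 4≤n∸k i j m
  ... | w , w~ci , w~cj , w≁si , w≁sj , w≢sm = H₃ , solution , fill≡3 ,
    λ { H (sparseH , G⊆H , si~sj) →
          fill≥3 H sparseH (G⊆H _ _) i≢j i≢m j≢m si~sj w~ci w~cj w≁si w≁sj w≢sm }
    where open Fill₃
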